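{- Let $G$ be a digraph which is the union of two cycle subdigraphs $G',G''$, i.e., $V(G)=V(G')\cup V(G'')$ and $E(G)=E(G')\cup E(G'')$, such that $V(G')\cap V(G'')\neq\emptyset$ and the subdigraph of $G$ induced on $V(G')\cap V(G'')$ is a directed path of length $|V(G')\cap V(G'')|-1$. Then every skew-symmetry $\sigma$ of $G$ has a unit, i.e., there is a vertex $v$ with $(v,\sigma(v))\in E(G)$.
   Context: A digraph has a finite vertex set and arcs $(a,b)$ with $a\ne b$, no parallel arcs. A cycle digraph is a strongly connected digraph in which every vertex has in-degree 1 and out-degree 1; a cycle of a digraph is a subdigraph isomorphic to a cycle digraph. A skew-symmetry of a digraph $G$ is a bijection $\sigma:V(G)\to V(G)$ with $\sigma(\sigma(v))=v$ and $\sigma(v)\ne v$ for all $v$, such that $(a,b)\in E(G)$ implies $(\sigma(b),\sigma(a))\in E(G)$. -}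

module Defs where

open import Data.Nat using (ℕ; suc)
open import Data.Fin using (Fin; toℕ)
open import Data.Product using (Σ; ∃; ∃!; _×_; _,_)
open import Data.Sum using (_⊎_)
open import Data.Empty using (⊥)
open import Relation.Nullary using (¬_)
open import Relation.Binary.PropositionalEquality using (_≡_; _≢_)
open import Relation.Binary.Construct.Closure.ReflexiveTransitive using (Star)
open import Function.Definitions using (Injective)

-- A digraph on the vertex set Fin n: an arc relation without loops.
-- (A relation automatically has no parallel arcs.)
record Digraph : Set₁ where
  field
    n     : ℕ
    Arc   : Fin n → Fin n → Set
    noLoop : ∀ v → ¬ Arc v v
open Digraph public

record Subdigraph (G : Digraph) : Set₁ where
  field
    V     : Fin (n G) → Set
    A     : Fin (n G) → Fin (n G) → Set
    A⊆E   : ∀ {a b} → A a b → Arc G a b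
    A-src : ∀ {a b} → A a b → V a
    A-tgt : ∀ {a b} → A a b → V b
open Subdigraph public

record IsCycle {G : Digraph} (H : Subdigraph G) : Set where
  field
    stronglyConnected : ∀ u w → V H u → V H w → Star (A H) u w
    outDeg1 : ∀ v → V H v → ∃! _≡_ (λ w → A H v w)
    inDeg1  : ∀ v → V H v → ∃! _≡_ (λ u → A H u v)

record IsSkewSymmetry (G : Digraph) (σ : Fin (n G) → Fin (n G)) : Set where
  field
    involutive : ∀ v → σ (σ v) ≡ v
    noFixed    : ∀ v → σ v ≢ v
    reverses   : ∀ a b → Arc G a b → Arc G (σ b) (σ a)

-- The subdigraph of G induced on the vertex set S is a directed path
-- with k vertices (i.e. of length k - 1), where k = |S|: there is a
-- bijection p : Fin k → S with  Arc (p i) (p j)  iff  j = i + 1.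
InducedIsPath : (G : Digraph) → (Fin (n G) → Set) → Set
InducedIsPath G S =
  Σ ℕ λ k → Σ (Fin k → Fin (n G)) λ p →
      Injective _≡_ _≡_ p
    × (∀ i → S (p i))
    × (∀ v → S v → ∃ λ i → p i ≡ v)
    × (∀ i j → (Arc G (p i) (p j) → toℕ j ≡ suc (toℕ i))
             × (toℕ j ≡ suc (toℕ i) → Arc G (p i) (p j)))

module Submission where

-- 1. σ maps P into P.  If v ∈ P but σ v ∉ P, say σ v ∈ C₁ ∖ C₂, follow
--    C₁ from σ v back to v.  Along this walk, every vertex z outside C₂
--    has σ z on both cycles, since the predecessors of σ z on C₁ and on
--    C₂ are both σ z₁ for the C₁-successor z₁ of z ('UnionOfTwoCycles').
--    The walk must enter C₂ somewhere, and at that arc the mirror image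
--    forces z itself into C₂ — a contradiction.  As membership in a cycle
--    need not be decidable, this yields ¬ ¬ (σ v ∈ P).
-- 2. Hence σ induces a map f on path indices with p (f i) = σ (p i); it
--    reverses the path and has no fixed point ('RestrictionToPath').
-- 3. A path-reversing map on 0, …, k-1 without fixed points has a
--    "unit" i ↦ i + 1, unless k = 0 ('path-reversal-has-unit').  Since
--    P ≠ ∅, some i has σ (p i) = p (i+1), which is an arc of G.

open import Defs
open import Data.Fin using (Fin; toℕ; fromℕ<)
open import Data.Fin.Properties using (any?; toℕ-fromℕ<; toℕ-injective; toℕ<n; ¬Fin0)
  renaming (_≟_ to _≟ᶠ_)
open import Data.Nat using (ℕ; zero; suc; _≤_; _<_; z≤n)
open import Data.Nat.Properties
  using (≤∧≢⇒<; <⇒≤; <-irrefl; ≤-trans; n<1+n; ≤-pred)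
  renaming (_≟_ to _≟ⁿ_)
open import Data.Product using (∃; _×_; _,_; proj₁; proj₂)
open import Data.Sum using (_⊎_; inj₁; inj₂; swap)
open import Data.Empty using (⊥; ⊥-elim)
open import Relation.Nullary using (¬_; Dec; yes; no)
open import Relation.Nullary.Decidable using (decidable-stable; ¬¬-excluded-middle; _×-dec_)
open import Relation.Binary.PropositionalEquality
  using (_≡_; _≢_; refl; sym; trans; cong; subst; subst₂)
open import Relation.Binary.Construct.Closure.ReflexiveTransitive using (Star; ε; _◅_)

successor-unique : ∀ {G} (C : Subdigraph G) → IsCycle C →
                   ∀ {x y y′} → A C x y → A C x y′ → y ≡ y′
successor-unique C cy {x} x→y x→y′ with IsCycle.outDeg1 cy x (A-src C x→y)
... | _ , _ , unique = trans (sym (unique x→y)) (unique x→y′)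

module SkewSymmetry {G : Digraph} {σ : Fin (n G) → Fin (n G)} (sk : IsSkewSymmetry G σ) where
  open IsSkewSymmetry sk

  σ-injective : ∀ {a b} → σ a ≡ σ b → a ≡ b
  σ-injective {a} {b} σa≡σb = trans (sym (involutive a)) (trans (cong σ σa≡σb) (involutive b))

  reverses-into-σ : ∀ {a b} → Arc G a (σ b) → Arc G b (σ a)
  reverses-into-σ {a} {b} arc = subst (λ x → Arc G x (σ a)) (involutive b) (reverses _ _ arc)

  holds-at-σσ : (P : Fin (n G) → Set) → ∀ {v} → P v → P (σ (σ v))
  holds-at-σσ P {v} = subst P (sym (involutive v))

module UnionOfTwoCycles {G : Digraph} (C₁ C₂ : Subdigraph G)
  (cy₁ : IsCycle C₁) (cy₂ : IsCycle C₂)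
  (cover : ∀ a b → Arc G a b → A C₁ a b ⊎ A C₂ a b)
  {σ : Fin (n G) → Fin (n G)} (sk : IsSkewSymmetry G σ) where
  open IsSkewSymmetry sk
  open SkewSymmetry sk

  arc-outside-C₂ : ∀ {x y} → ¬ V C₂ x → Arc G x y → A C₁ x y
  arc-outside-C₂ x∉C₂ arc with cover _ _ arc
  ... | inj₁ in-C₁ = in-C₁
  ... | inj₂ in-C₂ = ⊥-elim (x∉C₂ (A-src C₂ in-C₂))

  -- Mirror of a C₁-step z → z₁ with z ∉ C₂: if σ z lies on a cycle C
  -- (C₁ or C₂), its C-predecessor q satisfies z → σ q, so σ q = z₁.
  mirrored-step : (C : Subdigraph G) → IsCycle C → ∀ {z z₁} →
                  ¬ V C₂ z → A C₁ z z₁ → V C (σ z) → A C (σ z₁) (σ z)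
  mirrored-step C cy {z} {z₁} z∉C₂ z→z₁ σz∈C with IsCycle.inDeg1 cy (σ z) σz∈C
  ... | q , q→σz , _ = subst (λ x → A C x (σ z)) q≡σz₁ q→σz
    where
    z₁≡σq : z₁ ≡ σ q
    z₁≡σq = successor-unique C₁ cy₁ z→z₁ (arc-outside-C₂ z∉C₂ (reverses-into-σ (A⊆E C q→σz)))
    q≡σz₁ : q ≡ σ z₁
    q≡σz₁ = trans (sym (involutive q)) (cong σ (sym z₁≡σq))

  -- If σ z₁ → σ z lies on both cycles and z₁ ∈ C₂, then z ∈ C₂: the
  -- mirror of the C₂-arc c → z₁ is an arc σ z₁ → σ c, so σ c = σ z.
  entering-C₂ : ∀ {z z₁} → A C₁ (σ z₁) (σ z) → A C₂ (σ z₁) (σ z) → V C₂ z₁ → V C₂ z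
  entering-C₂ {z} {z₁} on-C₁ on-C₂ z₁∈C₂ with IsCycle.inDeg1 cy₂ z₁ z₁∈C₂
  ... | c , c→z₁ , _ = subst (V C₂) (sym (σ-injective σz≡σc)) (A-src C₂ c→z₁)
    where
    σz≡σc : σ z ≡ σ c
    σz≡σc with cover _ _ (reverses _ _ (A⊆E C₂ c→z₁))
    ... | inj₁ in-C₁ = successor-unique C₁ cy₁ on-C₁ in-C₁
    ... | inj₂ in-C₂ = successor-unique C₂ cy₂ on-C₂ in-C₂

  -- A C₁-walk from z ∉ C₂ with σ z ∈ C₁ ∩ C₂ never reaches C₂: by
  -- 'mirrored-step' the invariant passes to the next vertex, and by
  -- 'entering-C₂' that vertex cannot be in C₂.
  no-entry : ∀ {z t} → Star (A C₁) z t → V C₂ t → ¬ V C₂ z → V C₁ (σ z) → V C₂ (σ z) → ⊥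
  no-entry ε t∈C₂ z∉C₂ _ _ = z∉C₂ t∈C₂
  no-entry {z} (_◅_ {j = z₁} z→z₁ walk) t∈C₂ z∉C₂ σz∈C₁ σz∈C₂ =
    ¬¬-excluded-middle continue
    where
    on-C₁ = mirrored-step C₁ cy₁ z∉C₂ z→z₁ σz∈C₁
    on-C₂ = mirrored-step C₂ cy₂ z∉C₂ z→z₁ σz∈C₂
    continue : ¬ Dec (V C₂ z₁)
    continue (yes z₁∈C₂) = z∉C₂ (entering-C₂ on-C₁ on-C₂ z₁∈C₂)
    continue (no z₁∉C₂)  = no-entry walk t∈C₂ z₁∉C₂ (A-src C₁ on-C₁) (A-src C₂ on-C₂)

σ-preserves-intersection : ∀ {G} (C₁ C₂ : Subdigraph G) (cy₁ : IsCycle C₁) (cy₂ : IsCycle C₂) →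
  (∀ v → V C₁ v ⊎ V C₂ v) → (∀ a b → Arc G a b → A C₁ a b ⊎ A C₂ a b) →
  ∀ {σ} → IsSkewSymmetry G σ →
  ∀ {v} → V C₁ v → V C₂ v → ¬ ¬ (V C₁ (σ v) × V C₂ (σ v))
σ-preserves-intersection C₁ C₂ cy₁ cy₂ coverV coverA {σ} sk {v} v∈C₁ v∈C₂ σv∉both
  with coverV (σ v)
... | inj₁ σv∈C₁ = UnionOfTwoCycles.no-entry C₁ C₂ cy₁ cy₂ coverA sk
      (IsCycle.stronglyConnected cy₁ (σ v) v σv∈C₁ v∈C₁) v∈C₂
      (λ σv∈C₂ → σv∉both (σv∈C₁ , σv∈C₂)) (holds-at-σσ (V C₁) v∈C₁) (holds-at-σσ (V C₂) v∈C₂)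
  where open SkewSymmetry sk using (holds-at-σσ)
... | inj₂ σv∈C₂ = UnionOfTwoCycles.no-entry C₂ C₁ cy₂ cy₁ (λ a b arc → swap (coverA a b arc)) sk
      (IsCycle.stronglyConnected cy₂ (σ v) v σv∈C₂ v∈C₂) v∈C₁
      (λ σv∈C₁ → σv∉both (σv∈C₁ , σv∈C₂)) (holds-at-σσ (V C₂) v∈C₂) (holds-at-σσ (V C₁) v∈C₁)
  where open SkewSymmetry sk using (holds-at-σσ)

module RestrictionToPath {G : Digraph} {S : Fin (n G) → Set} {k : ℕ} (p : Fin k → Fin (n G))
  (p-in : ∀ i → S (p i)) (p-onto : ∀ v → S v → ∃ λ i → p i ≡ v)
  (p-arc : ∀ i j → (Arc G (p i) (p j) → toℕ j ≡ suc (toℕ i))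
                 × (toℕ j ≡ suc (toℕ i) → Arc G (p i) (p j)))
  {σ : Fin (n G) → Fin (n G)} (sk : IsSkewSymmetry G σ)
  (σ-invariant : ∀ {v} → S v → ¬ ¬ S (σ v)) where
  open IsSkewSymmetry sk

  -- The index of σ (p i); it exists since "some index is hit" is decidable.
  index-of-σ : ∀ i → ∃ λ j → p j ≡ σ (p i)
  index-of-σ i = decidable-stable (any? (λ j → p j ≟ᶠ σ (p i)))
    (λ no-index → σ-invariant (p-in i) (λ σpi∈S → no-index (p-onto (σ (p i)) σpi∈S)))

  f : Fin k → Fin k
  f i = proj₁ (index-of-σ i)

  f-spec : ∀ i → p (f i) ≡ σ (p i)
  f-spec i = proj₂ (index-of-σ i)

  -- The arc p i → p j is mirrored to p (f j) → p (f i).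
  f-reverses : ∀ i j → toℕ j ≡ suc (toℕ i) → toℕ (f i) ≡ suc (toℕ (f j))
  f-reverses i j j≡1+i = proj₁ (p-arc (f j) (f i))
    (subst₂ (Arc G) (sym (f-spec j)) (sym (f-spec i)) (reverses _ _ (proj₂ (p-arc i j) j≡1+i)))

  f-no-fixed-point : ∀ i → f i ≢ i
  f-no-fixed-point i fi≡i = noFixed (p i) (trans (sym (f-spec i)) (cong p fi≡i))

-- Step 3: a map f on the path 0 → 1 → … → k-1 that reverses it, has no
-- fixed point and no unit i ↦ i + 1 exists only for k = 0.  Indeed such
-- an f moves every index strictly upwards, which fails at k - 1.
module PathReversal {k : ℕ} (f : Fin k → Fin k)
  (reverses : ∀ i j → toℕ j ≡ suc (toℕ i) → toℕ (f i) ≡ suc (toℕ (f j)))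
  (no-fixed-point : ∀ i → f i ≢ i)
  (no-unit : ∀ i → toℕ (f i) ≢ suc (toℕ i)) where

  not-fixed : ∀ {m} (m<k : m < k) → m ≢ toℕ (f (fromℕ< m<k))
  not-fixed m<k m≡fm = no-fixed-point _ (toℕ-injective (trans (sym m≡fm) (sym (toℕ-fromℕ< m<k))))

  moves-up : ∀ m (m<k : m < k) → m < toℕ (f (fromℕ< m<k))
  moves-up zero m<k = ≤∧≢⇒< z≤n (not-fixed m<k)
  moves-up (suc m) 1+m<k = ≤∧≢⇒< 1+m≤fj (not-fixed 1+m<k)
    where
    m<k : m < k
    m<k = ≤-trans (n<1+n m) (<⇒≤ 1+m<k)
    i = fromℕ< m<k
    j = fromℕ< 1+m<k
    j≡1+i : toℕ j ≡ suc (toℕ i)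
    j≡1+i = trans (toℕ-fromℕ< 1+m<k) (cong suc (sym (toℕ-fromℕ< m<k)))
    -- f i > m and f i ≠ m + 1, so f j = f i - 1 > m.
    1+m<fi : suc m < toℕ (f i)
    1+m<fi = ≤∧≢⇒< (moves-up m m<k)
      (λ 1+m≡fi → no-unit i (trans (sym 1+m≡fi) (cong suc (sym (toℕ-fromℕ< m<k)))))
    1+m≤fj : suc m ≤ toℕ (f j)
    1+m≤fj = ≤-pred (subst (suc (suc m) ≤_) (reverses i j j≡1+i) 1+m<fi)

  empty : ¬ Fin k
  empty = last k refl
    where
    last : ∀ k′ → k′ ≡ k → ¬ Fin k
    last zero k≡0 i = ¬Fin0 (subst Fin (sym k≡0) i)
    last (suc k′) 1+k′≡k _ = <-irrefl refl
      (≤-trans (moves-up k′ k′<k) (≤-pred (subst (toℕ (f (fromℕ< k′<k)) <_) (sym 1+k′≡k) (toℕ<n _))))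
      where
      k′<k : k′ < k
      k′<k = subst (k′ <_) 1+k′≡k (n<1+n k′)

lemma7p6 : (G : Digraph) (G' G'' : Subdigraph G) →
    IsCycle G' → IsCycle G'' →
    (∀ v → V G' v ⊎ V G'' v) →
    (∀ a b → Arc G a b → A G' a b ⊎ A G'' a b) →
    (∃ λ v → V G' v × V G'' v) →
    InducedIsPath G (λ v → V G' v × V G'' v) →
    (σ : Fin (n G) → Fin (n G)) → IsSkewSymmetry G σ →
    ∃ λ v → Arc G v (σ v)
lemma7p6 G G' G'' cy' cy'' coverV coverA (v , v∈both) (k , p , _ , p-in , p-onto , p-arc) σ sk
  with any? (λ i → any? (λ j → (p j ≟ᶠ σ (p i)) ×-dec (toℕ j ≟ⁿ suc (toℕ i))))
... | yes (i , j , pj≡σpi , j≡1+i) = p i , subst (Arc G (p i)) pj≡σpi (proj₂ (p-arc i j) j≡1+i)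
... | no no-unit-on-path = ⊥-elim (PathReversal.empty f f-reverses f-no-fixed-point no-unit
                                      (proj₁ (p-onto v v∈both)))
  where
  open RestrictionToPath p p-in p-onto p-arc sk
    (λ (v∈G' , v∈G'') → σ-preserves-intersection G' G'' cy' cy'' coverV coverA sk v∈G' v∈G'')
  no-unit : ∀ i → toℕ (f i) ≢ suc (toℕ i)
  no-unit i fi≡1+i = no-unit-on-path (i , f i , f-spec i , fi≡1+i)
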